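{- Let $\rho=l\to r$ be a linear term rewrite rule over a signature $\Sigma$ and $s$ a linear term. If $\rho^\circ$ is applied at position $p$ in $s^\circ$ and gives rise to a PBPO$^+$ rewrite step $s^\circ\Rightarrow G$, then $G$ is uniquely determined up to isomorphism (by $\rho$, $s$ and $p$).
   Context: Terms over a signature $\Sigma$ (arities $\#$) and variables $\mathcal{X}$; linear = each variable at most once; positions are sequences of positive integers; rules $l\to r$ with $l\notin\mathcal{X}$, $\mathrm{Var}(r)\subseteq\mathrm{Var}(l)$, linear if $l,r$ linear. Graphs are labeled in the flat lattice $\Sigma^\circ=(\Sigma\uplus\mathbb{N}^+)\uplus\{\bot,\top\}$ ($\bot$ least, $\top$ greatest, others incomparable); morphisms preserve source/target and do not decrease labels. PBPO$^+$: a rule consists of $L,K,R,L',K'$, $l:K\to L$, $r:K\to R$, $l':K'\to L'$, monos $t_L:L\rightarrowtail L'$, $t_K:K\rightarrowtail K'$ with $t_L\circ l=l'\circ t_K$ a pullback. A step $G_L\Rightarrow G_R$ holds if there are a mono $m:L\rightarrowtail G_L$ and $\alpha:G_L\to L'$ with $\alpha\circ m=t_L$ and ($L$, $1_L$, $m$) a pullback of $t_L,\alpha$; $(G_K,g_L,u')$ a pullback of $\alpha$ and $l'$; $u:K\to G_K$ the unique morphism with $u'\circ u=t_K$, $g_L\circ u=m\circ l$; and $G_R$ a pushout of $u$ and $r$. Encodings: $t^\circ$ has a vertex $p$ labeled $f$ per position $p$ holding symbol $f$, a vertex $x$ labeled $\bot$ per variable $x$, and an edge labeled $i$ from the vertex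 at $p$ to that at $pi$; root at $\epsilon$; vertex positions as in the term. The context closure $\mathcal{C}[G{\downarrow_\mathcal{X}}]$ of a rooted graph: relabel each variable vertex $x$ to $\top$, add fresh $\top$-vertex $x'$ with $\top$-edges $x\to x'$, $x'\to x'$; add fresh $\top$-vertex $\mathcal{C}$ with $\top$-edges $\mathcal{C}\to$ root and $\mathcal{C}\to\mathcal{C}$. $\mathcal{I}(r)$: discrete graph on $\mathrm{Var}(r)\cup\{\epsilon\}$, all labeled $\bot$, root $\epsilon$. $\rho^\circ$: $L=l^\circ$, $K=\mathcal{I}(r)$, $R=r^\circ$, $L'=\mathcal{C}[l^\circ{\downarrow_\mathcal{X}}]$, $K'=\mathcal{C}[\mathcal{I}(r){\downarrow_\mathcal{X}}]$, morphisms mapping roots to roots, inclusions otherwise. $\rho^\circ$ is applied at position $p$ in $s^\circ$ if the match $m$ maps the root of $l^\circ$ to the vertex of $s^\circ$ at position $p$. -}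

module Defs where

open import Data.Nat using (ℕ)
open import Data.Fin using (Fin; toℕ)
open import Data.Bool using (Bool; true; false; T)
open import Data.Unit using (⊤; tt)
open import Data.Empty using (⊥)
open import Data.Sum using (_⊎_; inj₁; inj₂)
open import Data.Product using (Σ; _×_; _,_; proj₁; proj₂)
import Relation.Binary.PropositionalEquality
open Relation.Binary.PropositionalEquality using (_≡_; refl; trans; cong; subst)

record Signature : Set₁ where
  field
    Sym : Set
    ar  : Sym → ℕ

-- Graphs labeled in the flat lattice Σ° = (Σ ⊎ ℕ⁺) ⊎ {⊥, ⊤}

module Graphs (Sym : Set) where

  data Label : Set where
    sym : Sym → Label
    num : ℕ → Label        -- num n represents the positive number n + 1
    bot : Label
    top : Label

  data _⊑_ : Label → Label → Set where
    ⊑-refl : ∀ {a} → a ⊑ a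
    bot⊑   : ∀ {a} → bot ⊑ a
    ⊑top   : ∀ {a} → a ⊑ top

  ⊑-trans : ∀ {a b c} → a ⊑ b → b ⊑ c → a ⊑ c
  ⊑-trans ⊑-refl y = y
  ⊑-trans bot⊑ y = bot⊑
  ⊑-trans ⊑top ⊑-refl = ⊑top
  ⊑-trans ⊑top ⊑top = ⊑top

  record Graph : Set₁ where
    field
      V E     : Set
      src tgt : E → V
      lV      : V → Label
      lE      : E → Label

  open Graph

  record Hom (G H : Graph) : Set where
    field
      fV       : V G → V H
      fE       : E G → E H
      src-pres : ∀ e → fV (src G e) ≡ src H (fE e)
      tgt-pres : ∀ e → fV (tgt G e) ≡ tgt H (fE e)
      lV-mono  : ∀ v → lV G v ⊑ lV H (fV v)
      lE-mono  : ∀ e → lE G e ⊑ lE H (fE e)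

  open Hom

  idH : ∀ {G} → Hom G G
  idH = record
    { fV = λ v → v ; fE = λ e → e
    ; src-pres = λ _ → refl ; tgt-pres = λ _ → refl
    ; lV-mono = λ _ → ⊑-refl ; lE-mono = λ _ → ⊑-refl }

  infixr 9 _∘ₕ_
  _∘ₕ_ : ∀ {A B C} → Hom B C → Hom A B → Hom A C
  g ∘ₕ f = record
    { fV = λ v → fV g (fV f v)
    ; fE = λ e → fE g (fE f e)
    ; src-pres = λ e → trans (cong (fV g) (src-pres f e)) (src-pres g (fE f e))
    ; tgt-pres = λ e → trans (cong (fV g) (tgt-pres f e)) (tgt-pres g (fE f e))
    ; lV-mono = λ v → ⊑-trans (lV-mono f v) (lV-mono g (fV f v))
    ; lE-mono = λ e → ⊑-trans (lE-mono f e) (lE-mono g (fE f e)) }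

  infix 4 _≈_
  _≈_ : ∀ {G H} → Hom G H → Hom G H → Set
  f ≈ g = (∀ v → fV f v ≡ fV g v) × (∀ e → fE f e ≡ fE g e)

  Mono : ∀ {A B} → Hom A B → Set₁
  Mono {A} {B} m = ∀ (X : Graph) (f g : Hom X A) → m ∘ₕ f ≈ m ∘ₕ g → f ≈ g

  IsPullback : ∀ {A B C P} → Hom A C → Hom B C → Hom P A → Hom P B → Set₁
  IsPullback {A} {B} {C} {P} f g p₁ p₂ =
    (f ∘ₕ p₁ ≈ g ∘ₕ p₂) ×
    (∀ (X : Graph) (a : Hom X A) (b : Hom X B) → f ∘ₕ a ≈ g ∘ₕ b →
       Σ (Hom X P) λ h → (p₁ ∘ₕ h ≈ a) × (p₂ ∘ₕ h ≈ b) ×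
         (∀ (h' : Hom X P) → p₁ ∘ₕ h' ≈ a → p₂ ∘ₕ h' ≈ b → h' ≈ h))

  IsPushout : ∀ {A B C Q} → Hom A B → Hom A C → Hom B Q → Hom C Q → Set₁
  IsPushout {A} {B} {C} {Q} f g i₁ i₂ =
    (i₁ ∘ₕ f ≈ i₂ ∘ₕ g) ×
    (∀ (X : Graph) (b : Hom B X) (c : Hom C X) → b ∘ₕ f ≈ c ∘ₕ g →
       Σ (Hom Q X) λ h → (h ∘ₕ i₁ ≈ b) × (h ∘ₕ i₂ ≈ c) ×
         (∀ (h' : Hom Q X) → h' ∘ₕ i₁ ≈ b → h' ∘ₕ i₂ ≈ c → h' ≈ h))

  infix 4 _≅_
  _≅_ : Graph → Graph → Set
  G ≅ H = Σ (Hom G H) λ f → Σ (Hom H G) λ g → (g ∘ₕ f ≈ idH) × (f ∘ₕ g ≈ idH)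

  record PRule : Set₁ where
    field
      L K R L' K' : Graph
      l  : Hom K L
      r  : Hom K R
      l' : Hom K' L'
      tL : Hom L L'
      tK : Hom K K'

  record Step (ρ : PRule) (GL GR : Graph) (m : Hom (PRule.L ρ) GL) : Set₁ where
    open PRule ρ
    field
      m-mono : Mono m
      α      : Hom GL L'
      α-m    : α ∘ₕ m ≈ tL
      pb₁    : IsPullback tL α (idH {L}) m
      GK     : Graph
      gL     : Hom GK GL
      u'     : Hom GK K'
      pb₂    : IsPullback α l' gL u'
      u      : Hom K GK
      u-tK   : u' ∘ₕ u ≈ tK
      u-l    : gL ∘ₕ u ≈ m ∘ₕ l
      gR     : Hom GK GR
      w      : Hom R GR
      po     : IsPushout u r gR w

module Terms (Sig : Signature) (X : Set) where
  open Signature Sig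
  open Graphs Sym public

  data Term : Set where
    var : X → Term
    fun : (f : Sym) → (Fin (ar f) → Term) → Term

  -- positions of a term (i ∷ q stands for the position (i+1)q)
  data Pos : Term → Set where
    ε   : ∀ {t} → Pos t
    _∷_ : ∀ {f ts} (i : Fin (ar f)) → Pos (ts i) → Pos (fun f ts)

  _at_ : (t : Term) → Pos t → Term
  t at ε = t
  fun f ts at (i ∷ q) = ts i at q

  isVar : Term → Bool
  isVar (var _)   = true
  isVar (fun _ _) = false

  Occ : Term → X → Set
  Occ t x = Σ (Pos t) λ q → t at q ≡ var x

  Linear : Term → Set
  Linear t = ∀ x (o₁ o₂ : Occ t x) → proj₁ o₁ ≡ proj₁ o₂

  record Rule : Set where
    field
      lhs rhs  : Term
      lhs-fun  : isVar lhs ≡ false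
      var-incl : ∀ x → Occ rhs x → Occ lhs x

  LinearRule : Rule → Set
  LinearRule ρ = Linear (Rule.lhs ρ) × Linear (Rule.rhs ρ)

  record RGraph : Set₁ where
    field
      graph  : Graph
      root   : Graph.V graph
      isVarV : Graph.V graph → Bool

  -- edges of t°: one edge from p to p i for every position p i
  data Edge : Term → Set where
    edge : ∀ {f ts} (i : Fin (ar f)) → Edge (fun f ts)
    down : ∀ {f ts} (i : Fin (ar f)) → Edge (ts i) → Edge (fun f ts)

  esrc : ∀ {t} → Edge t → Pos t
  esrc (edge i)   = ε
  esrc (down i e) = i ∷ esrc e

  etgt : ∀ {t} → Edge t → Pos t
  etgt (edge i)   = i ∷ ε
  etgt (down i e) = i ∷ etgt e

  elab : ∀ {t} → Edge t → Label
  elab (edge i)   = num (toℕ i)   -- label i+1 for the (i+1)-th argument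
  elab (down i e) = elab e

  termLabel : Term → Label
  termLabel (var _)   = bot
  termLabel (fun f _) = sym f

  _° : Term → RGraph
  t ° = record
    { graph = record
        { V = Pos t ; E = Edge t ; src = esrc ; tgt = etgt
        ; lV = λ q → termLabel (t at q) ; lE = elab }
    ; root = ε
    ; isVarV = λ q → isVar (t at q) }

  𝓘 : Term → RGraph
  𝓘 r = record
    { graph = record
        { V = ⊤ ⊎ Σ X (Occ r) ; E = ⊥ ; src = λ () ; tgt = λ ()
        ; lV = λ _ → bot ; lE = λ () }
    ; root = inj₁ tt
    ; isVarV = λ { (inj₁ _) → false ; (inj₂ _) → true } }

  relabel : Bool → Label → Label
  relabel true  _ = top
  relabel false a = a

  module _ (G : RGraph) where
    open RGraph G
    open Graph graph

    data CV : Set where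
      old  : V → CV
      var' : (v : V) → T (isVarV v) → CV
      ctx  : CV

    data CE : Set where
      old   : E → CE
      toVar : (v : V) → T (isVarV v) → CE
      loopV : (v : V) → T (isVarV v) → CE
      toRoot : CE
      loopC  : CE

    csrc : CE → CV
    csrc (old e)     = old (src e)
    csrc (toVar v p) = old v
    csrc (loopV v p) = var' v p
    csrc toRoot      = ctx
    csrc loopC       = ctx

    ctgt : CE → CV
    ctgt (old e)     = old (tgt e)
    ctgt (toVar v p) = var' v p
    ctgt (loopV v p) = var' v p
    ctgt toRoot      = old root
    ctgt loopC       = ctx

    clV : CV → Label
    clV (old v) = relabel (isVarV v) (lV v)
    clV (var' _ _) = top
    clV ctx = top

    clE : CE → Label
    clE (old e) = lE e
    clE _ = top

  𝓒 : RGraph → Graph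
  𝓒 G = record
    { V = CV G ; E = CE G ; src = csrc G ; tgt = ctgt G ; lV = clV G ; lE = clE G }

  ⌊_⌋ : RGraph → Graph
  ⌊ G ⌋ = RGraph.graph G

  private
    ⊑relabel : ∀ b a → a ⊑ relabel b a
    ⊑relabel true  a = ⊑top
    ⊑relabel false a = ⊑-refl

    top⊑relabel : ∀ b a → T b → top ⊑ relabel b a
    top⊑relabel true a _ = ⊑-refl

  ιC : (G : RGraph) → Hom ⌊ G ⌋ (𝓒 G)
  ιC G = record
    { fV = old ; fE = old
    ; src-pres = λ _ → refl ; tgt-pres = λ _ → refl
    ; lV-mono = λ v → ⊑relabel (RGraph.isVarV G v) (Graph.lV ⌊ G ⌋ v)
    ; lE-mono = λ _ → ⊑-refl }

  module RuleEnc (ρ : Rule) where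
    open Rule ρ

    lV : Graph.V ⌊ 𝓘 rhs ⌋ → Pos lhs
    lV (inj₁ _)       = ε
    lV (inj₂ (x , o)) = proj₁ (var-incl x o)

    lHom : Hom ⌊ 𝓘 rhs ⌋ ⌊ lhs ° ⌋
    lHom = record
      { fV = lV ; fE = λ () ; src-pres = λ () ; tgt-pres = λ ()
      ; lV-mono = λ _ → bot⊑ ; lE-mono = λ () }

    rV : Graph.V ⌊ 𝓘 rhs ⌋ → Pos rhs
    rV (inj₁ _)       = ε
    rV (inj₂ (x , o)) = proj₁ o

    rHom : Hom ⌊ 𝓘 rhs ⌋ ⌊ rhs ° ⌋
    rHom = record
      { fV = rV ; fE = λ () ; src-pres = λ () ; tgt-pres = λ ()
      ; lV-mono = λ _ → bot⊑ ; lE-mono = λ () }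

    varPres : ∀ v → T (RGraph.isVarV (𝓘 rhs) v) → T (isVar (lhs at lV v))
    varPres (inj₂ (x , o)) _ =
      subst (λ t → T (isVar t)) (Relation.Binary.PropositionalEquality.sym (proj₂ (var-incl x o))) tt
    varPres (inj₁ _) ()

    l'V : CV (𝓘 rhs) → CV (lhs °)
    l'V (old v)    = old (lV v)
    l'V (var' v p) = var' (lV v) (varPres v p)
    l'V ctx        = ctx

    l'E : CE (𝓘 rhs) → CE (lhs °)
    l'E (old ())
    l'E (toVar v p) = toVar (lV v) (varPres v p)
    l'E (loopV v p) = loopV (lV v) (varPres v p)
    l'E toRoot      = toRoot
    l'E loopC       = loopC

    l'src : ∀ e → l'V (csrc (𝓘 rhs) e) ≡ csrc (lhs °) (l'E e)
    l'src (old ())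
    l'src (toVar v p) = refl
    l'src (loopV v p) = refl
    l'src toRoot      = refl
    l'src loopC       = refl

    l'tgt : ∀ e → l'V (ctgt (𝓘 rhs) e) ≡ ctgt (lhs °) (l'E e)
    l'tgt (old ())
    l'tgt (toVar v p) = refl
    l'tgt (loopV v p) = refl
    l'tgt toRoot      = refl
    l'tgt loopC       = refl

    l'lV : ∀ v → clV (𝓘 rhs) v ⊑ clV (lhs °) (l'V v)
    l'lV (old (inj₁ _)) = bot⊑
    l'lV (old (inj₂ (x , o))) =
      top⊑relabel (isVar (lhs at lV (inj₂ (x , o)))) _ (varPres (inj₂ (x , o)) tt)
    l'lV (var' v p) = ⊑-refl
    l'lV ctx        = ⊑-refl

    l'lE : ∀ e → clE (𝓘 rhs) e ⊑ clE (lhs °) (l'E e)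
    l'lE (old ())
    l'lE (toVar v p) = ⊑-refl
    l'lE (loopV v p) = ⊑-refl
    l'lE toRoot      = ⊑-refl
    l'lE loopC       = ⊑-refl

    l'Hom : Hom (𝓒 (𝓘 rhs)) (𝓒 (lhs °))
    l'Hom = record
      { fV = l'V ; fE = l'E ; src-pres = l'src ; tgt-pres = l'tgt
      ; lV-mono = l'lV ; lE-mono = l'lE }

  _°ʳ : Rule → PRule
  ρ °ʳ = record
    { L = ⌊ lhs ° ⌋ ; K = ⌊ 𝓘 rhs ⌋ ; R = ⌊ rhs ° ⌋
    ; L' = 𝓒 (lhs °) ; K' = 𝓒 (𝓘 rhs)
    ; l = lHom ; r = rHom ; l' = l'Hom
    ; tL = ιC (lhs °) ; tK = ιC (𝓘 rhs) }
    where open Rule ρ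
          open RuleEnc ρ

  AppliedAt : (ρ : Rule) (s : Term) (p : Pos s) (G : Graph) → Set₁
  AppliedAt ρ s p G =
    Σ (Hom ⌊ Rule.lhs ρ ° ⌋ ⌊ s ° ⌋) λ m →
      (Hom.fV m (RGraph.root (Rule.lhs ρ °)) ≡ p) × Step (ρ °ʳ) ⌊ s ° ⌋ G m

-- A morphism out of a term graph t° is determined by the image of its root: edges are
-- determined by their source and numeric label, and every position is reached from ε along
-- edges.  Hence two matches with the same root image coincide.  The typing α : s° → L' is
-- then forced as well.  The pullback condition on (L, 1_L, m) makes the vertices sent into
-- l° exactly those in the image of the match; every other vertex goes to the context vertex
-- or to the fresh vertex x' of a variable, and an edge of L' with such a target is determined
-- by its source.  At the root α cannot pick some x', which reaches only itself, whereas α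
-- sends the match position p into l°.  With match and typing fixed, G_K is a pullback and G_R
-- a pushout of the same diagram, hence both are unique up to isomorphism.
module Submission where

open import Defs
open import Data.Bool.Properties using (T-irrelevant)
open import Data.Empty using (⊥; ⊥-elim)
open import Data.Fin using (Fin)
open import Data.Fin.Properties using (toℕ-injective)
open import Data.Product using (Σ; _×_; _,_; proj₁; proj₂)
open import Data.Sum using (_⊎_; inj₁; inj₂)
open import Data.Unit using (⊤; tt)
open import Function using (_∘_)
open import Relation.Nullary using (¬_)
open import Relation.Binary.PropositionalEquality as ≡
  using (_≡_; _≗_; refl; trans; cong; subst; module ≡-Reasoning)

module GraphCategory (Sym : Set) where
  open Graphs Sym
  open Graph
  open Hom

  private variable
    A B C D : Graph
    W X Y Z : Set

  -- `f ≈ g` unfolds to pointwise equations between the vertex and edge maps, from which Agda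
  -- cannot recover the morphisms f and g themselves; the combinators are therefore stated
  -- for pairs of maps, and `f ≈ g` is definitionally `(fV f , fE f) ≗₂ (fV g , fE g)`.
  infix 4 _≗₂_
  _≗₂_ : (W → X) × (Y → Z) → (W → X) × (Y → Z) → Set
  f ≗₂ g = proj₁ f ≗ proj₁ g × proj₂ f ≗ proj₂ g

  ≈-refl : {f : (W → X) × (Y → Z)} → f ≗₂ f
  ≈-refl = (λ _ → refl) , (λ _ → refl)

  ≈-sym : {f g : (W → X) × (Y → Z)} → f ≗₂ g → g ≗₂ f
  ≈-sym (v , e) = ≡.sym ∘ v , ≡.sym ∘ e

  ≈-trans : {f g h : (W → X) × (Y → Z)} → f ≗₂ g → g ≗₂ h → f ≗₂ h
  ≈-trans (v , e) (v' , e') = (λ x → trans (v x) (v' x)) , (λ x → trans (e x) (e' x))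

  ∘ₕ-congˡ : (k : Hom B C) {f g : (W → V B) × (X → E B)} → f ≗₂ g →
    (fV k ∘ proj₁ f , fE k ∘ proj₂ f) ≗₂ (fV k ∘ proj₁ g , fE k ∘ proj₂ g)
  ∘ₕ-congˡ k (v , e) = cong (fV k) ∘ v , cong (fE k) ∘ e

  ∘ₕ-congʳ : (h : Hom A B) {f g : (V B → W) × (E B → X)} → f ≗₂ g →
    (proj₁ f ∘ fV h , proj₂ f ∘ fE h) ≗₂ (proj₁ g ∘ fV h , proj₂ g ∘ fE h)
  ∘ₕ-congʳ h (v , e) = v ∘ fV h , e ∘ fE h

  src-≡ : (h₁ h₂ : Hom A B) (e : E A) →
    fV h₁ (src A e) ≡ fV h₂ (src A e) → src B (fE h₁ e) ≡ src B (fE h₂ e)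
  src-≡ h₁ h₂ e eq = trans (≡.sym (src-pres h₁ e)) (trans eq (src-pres h₂ e))

  tgt-≡ : (h₁ h₂ : Hom A B) (e : E A) →
    fV h₁ (tgt A e) ≡ fV h₂ (tgt A e) → tgt B (fE h₁ e) ≡ tgt B (fE h₂ e)
  tgt-≡ h₁ h₂ e eq = trans (≡.sym (tgt-pres h₁ e)) (trans eq (tgt-pres h₂ e))

  IsIso : Hom A B → Set
  IsIso {A} {B} f = Σ (Hom B A) λ g → g ∘ₕ f ≈ idH × f ∘ₕ g ≈ idH

  Pt : Graph
  Pt = record { V = ⊤ ; E = ⊥ ; src = λ () ; tgt = λ () ; lV = λ _ → bot ; lE = λ () }

  point : V A → Hom Pt A
  point x = record
    { fV = λ _ → x ; fE = λ () ; src-pres = λ () ; tgt-pres = λ ()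
    ; lV-mono = λ _ → bot⊑ ; lE-mono = λ () }

  record Pullback (f : Hom A C) (g : Hom B C) : Set₁ where
    field
      P          : Graph
      p₁         : Hom P A
      p₂         : Hom P B
      isPullback : IsPullback f g p₁ p₂

    commutes : f ∘ₕ p₁ ≈ g ∘ₕ p₂
    commutes = proj₁ isPullback

    mediate : (a : Hom D A) (b : Hom D B) → f ∘ₕ a ≈ g ∘ₕ b →
      Σ (Hom D P) λ h → p₁ ∘ₕ h ≈ a × p₂ ∘ₕ h ≈ b
    mediate a b c with proj₂ isPullback _ a b c
    ... | h , ha , hb , _ = h , ha , hb

    jointly-mono : (h h' : Hom D P) → p₁ ∘ₕ h ≈ p₁ ∘ₕ h' → p₂ ∘ₕ h ≈ p₂ ∘ₕ h' → h ≈ h'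
    jointly-mono h h' e₁ e₂ with proj₂ isPullback _ (p₁ ∘ₕ h) (p₂ ∘ₕ h) (∘ₕ-congʳ h commutes)
    ... | _ , _ , _ , unique =
      ≈-trans (unique h ≈-refl ≈-refl) (≈-sym (unique h' (≈-sym e₁) (≈-sym e₂)))

    vertex-pair : ∀ {a b} → fV f a ≡ fV g b → Σ (V P) λ x → fV p₁ x ≡ a × fV p₂ x ≡ b
    vertex-pair eq with mediate (point _) (point _) ((λ _ → eq) , λ ())
    ... | h , ha , hb = fV h tt , proj₁ ha tt , proj₁ hb tt

  pullback-respˡ-≈ : {f f' : Hom A C} {g : Hom B C} → f ≈ f' → Pullback f g → Pullback f' g
  pullback-respˡ-≈ f≈f' X = record
    { P = P ; p₁ = p₁ ; p₂ = p₂
    ; isPullback = ≈-trans (∘ₕ-congʳ p₁ (≈-sym f≈f')) commutes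
                 , λ D a b f'a≈gb → proj₂ isPullback D a b (≈-trans (∘ₕ-congʳ a f≈f') f'a≈gb) }
    where open Pullback X

  module _ {f : Hom A C} {g : Hom B C} (X Y : Pullback f g) where
    private
      module X = Pullback X
      module Y = Pullback Y

    pullback-iso : Σ (Hom X.P Y.P) λ φ → IsIso φ × Y.p₁ ∘ₕ φ ≈ X.p₁ × Y.p₂ ∘ₕ φ ≈ X.p₂
    pullback-iso with Y.mediate X.p₁ X.p₂ X.commutes | X.mediate Y.p₁ Y.p₂ Y.commutes
    ... | φ , φ₁ , φ₂ | ψ , ψ₁ , ψ₂ =
      φ , (ψ , ψφ≈id , φψ≈id) , φ₁ , φ₂
      where
      ψφ≈id : ψ ∘ₕ φ ≈ idH
      ψφ≈id = X.jointly-mono (ψ ∘ₕ φ) idH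
        (≈-trans (∘ₕ-congʳ φ ψ₁) φ₁) (≈-trans (∘ₕ-congʳ φ ψ₂) φ₂)
      φψ≈id : φ ∘ₕ ψ ≈ idH
      φψ≈id = Y.jointly-mono (φ ∘ₕ ψ) idH
        (≈-trans (∘ₕ-congʳ ψ φ₁) ψ₁) (≈-trans (∘ₕ-congʳ ψ φ₂) ψ₂)

  record Pushout (f : Hom A B) (g : Hom A C) : Set₁ where
    field
      Q         : Graph
      i₁        : Hom B Q
      i₂        : Hom C Q
      isPushout : IsPushout f g i₁ i₂

    commutes : i₁ ∘ₕ f ≈ i₂ ∘ₕ g
    commutes = proj₁ isPushout

    mediate : (b : Hom B D) (c : Hom C D) → b ∘ₕ f ≈ c ∘ₕ g →
      Σ (Hom Q D) λ h → h ∘ₕ i₁ ≈ b × h ∘ₕ i₂ ≈ c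
    mediate b c e with proj₂ isPushout _ b c e
    ... | h , hb , hc , _ = h , hb , hc

    jointly-epi : (h h' : Hom Q D) → h ∘ₕ i₁ ≈ h' ∘ₕ i₁ → h ∘ₕ i₂ ≈ h' ∘ₕ i₂ → h ≈ h'
    jointly-epi h h' e₁ e₂ with proj₂ isPushout _ (h ∘ₕ i₁) (h ∘ₕ i₂) (∘ₕ-congˡ h commutes)
    ... | _ , _ , _ , unique =
      ≈-trans (unique h ≈-refl ≈-refl) (≈-sym (unique h' (≈-sym e₁) (≈-sym e₂)))

  module _ {B₁ B₂ : Graph} {u₁ : Hom A B₁} {u₂ : Hom A B₂} {r : Hom A C}
           (X : Pushout u₁ r) (Y : Pushout u₂ r) where
    private
      module X = Pushout X
      module Y = Pushout Y

    pushout-iso : (φ : Hom B₁ B₂) → IsIso φ → φ ∘ₕ u₁ ≈ u₂ → X.Q ≅ Y.Q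
    pushout-iso φ (ψ , ψφ≈id , φψ≈id) φu₁≈u₂
      with X.mediate (Y.i₁ ∘ₕ φ) Y.i₂ (≈-trans (∘ₕ-congˡ Y.i₁ φu₁≈u₂) Y.commutes)
         | Y.mediate (X.i₁ ∘ₕ ψ) X.i₂ (≈-trans (∘ₕ-congˡ X.i₁ ψu₂≈u₁) X.commutes)
      where
      ψu₂≈u₁ : ψ ∘ₕ u₂ ≈ u₁
      ψu₂≈u₁ = ≈-trans (∘ₕ-congˡ ψ (≈-sym φu₁≈u₂)) (∘ₕ-congʳ u₁ ψφ≈id)
    ... | h , h₁ , h₂ | k , k₁ , k₂ = h , k , kh≈id , hk≈id
      where
      kh≈id : k ∘ₕ h ≈ idH
      kh≈id = X.jointly-epi (k ∘ₕ h) idH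
        (≈-trans (∘ₕ-congˡ k h₁) (≈-trans (∘ₕ-congʳ φ k₁) (∘ₕ-congˡ X.i₁ ψφ≈id)))
        (≈-trans (∘ₕ-congˡ k h₂) k₂)
      hk≈id : h ∘ₕ k ≈ idH
      hk≈id = Y.jointly-epi (h ∘ₕ k) idH
        (≈-trans (∘ₕ-congˡ h k₁) (≈-trans (∘ₕ-congʳ ψ h₁) (∘ₕ-congˡ Y.i₁ φψ≈id)))
        (≈-trans (∘ₕ-congˡ h k₂) h₂)

  module _ {ρ : PRule} {GL GR : Graph} {m : Hom (PRule.L ρ) GL} (S : Step ρ GL GR m) where
    open PRule ρ
    open Step S

    match-pullback : Pullback tL α
    match-pullback = record { P = L ; p₁ = idH ; p₂ = m ; isPullback = pb₁ }

    context-pullback : Pullback α l'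
    context-pullback = record { P = GK ; p₁ = gL ; p₂ = u' ; isPullback = pb₂ }

    result-pushout : Pushout u r
    result-pushout = record { Q = GR ; i₁ = gR ; i₂ = w ; isPushout = po }

    typed-by-tL⇒matched : ∀ {v w} → fV α v ≡ fV tL w → fV m w ≡ v
    typed-by-tL⇒matched eq with Pullback.vertex-pair match-pullback (≡.sym eq)
    ... | _ , refl , mx≡v = mx≡v

  module _ {ρ : PRule} {GL G₁ G₂ : Graph} {m₁ m₂ : Hom (PRule.L ρ) GL}
           (S₁ : Step ρ GL G₁ m₁) (S₂ : Step ρ GL G₂ m₂) (m₁≈m₂ : m₁ ≈ m₂) where
    open PRule ρ
    private
      module S₁ = Step S₁
      module S₂ = Step S₂

    typings-agree-on-tL : ∀ {v w} → fV S₁.α v ≡ fV tL w → fV S₂.α v ≡ fV tL w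
    typings-agree-on-tL {v} {w} eq = begin
      fV S₂.α v          ≡⟨ cong (fV S₂.α) (typed-by-tL⇒matched S₁ eq) ⟨
      fV S₂.α (fV m₁ w)  ≡⟨ cong (fV S₂.α) (proj₁ m₁≈m₂ w) ⟩
      fV S₂.α (fV m₂ w)  ≡⟨ proj₁ S₂.α-m w ⟩
      fV tL w            ∎
      where open ≡-Reasoning

    step-result-unique : S₁.α ≈ S₂.α → G₁ ≅ G₂
    step-result-unique α₁≈α₂
      with pullback-iso (pullback-respˡ-≈ α₁≈α₂ (context-pullback S₁)) (context-pullback S₂)
    ... | φ , φ-iso , gLφ , u'φ =
      pushout-iso (result-pushout S₁) (result-pushout S₂) φ φ-iso φu₁≈u₂
      where
      φu₁≈u₂ : φ ∘ₕ S₁.u ≈ S₂.u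
      φu₁≈u₂ = Pullback.jointly-mono (context-pullback S₂) (φ ∘ₕ S₁.u) S₂.u
        (≈-trans (∘ₕ-congʳ S₁.u gLφ)
          (≈-trans S₁.u-l (≈-trans (∘ₕ-congʳ l m₁≈m₂) (≈-sym S₂.u-l))))
        (≈-trans (∘ₕ-congʳ S₁.u u'φ) (≈-trans S₁.u-tK (≈-sym S₂.u-tK)))

module TermGraphs (Sig : Signature) (X : Set) where
  open Signature Sig
  open Terms Sig X
  open Graph
  open Hom
  open GraphCategory Sym

  edge-induction : ∀ {t} (Q : Pos t → Set) → Q ε → (∀ e → Q (esrc e) → Q (etgt e)) → ∀ q → Q q
  edge-induction Q base step ε = base
  edge-induction {fun f ts} Q base step (i ∷ q) =
    edge-induction (λ q' → Q (i ∷ q')) (step (edge i) base) (λ e → step (down i e)) q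

  IsNum : Label → Set
  IsNum (num _) = ⊤
  IsNum _       = ⊥

  elab-IsNum : ∀ {t} (e : Edge t) → IsNum (elab e)
  elab-IsNum (edge i)   = tt
  elab-IsNum (down i e) = elab-IsNum e

  ⊑-between-nums⇒≡ : ∀ {a b} → IsNum a → IsNum b → a ⊑ b → a ≡ b
  ⊑-between-nums⇒≡ {num _} {num _} _ _ ⊑-refl = refl

  ∷-injectiveˡ : ∀ {f ts} {i j : Fin (ar f)} {q : Pos (ts i)} {q' : Pos (ts j)} →
    _≡_ {A = Pos (fun f ts)} (i ∷ q) (j ∷ q') → i ≡ j
  ∷-injectiveˡ refl = refl

  ∷-injectiveʳ : ∀ {f ts} {i : Fin (ar f)} {q q' : Pos (ts i)} →
    _≡_ {A = Pos (fun f ts)} (i ∷ q) (i ∷ q') → q ≡ q'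
  ∷-injectiveʳ refl = refl

  Edge-≡ : ∀ {t} (e₁ e₂ : Edge t) → esrc e₁ ≡ esrc e₂ → elab e₁ ≡ elab e₂ → e₁ ≡ e₂
  Edge-≡ (edge i) (edge j) _ lab≡ = cong edge (toℕ-injective (num-injective lab≡))
    where
    num-injective : ∀ {a b} → num a ≡ num b → a ≡ b
    num-injective refl = refl
  Edge-≡ (down i e₁) (down j e₂) src≡ lab≡ with ∷-injectiveˡ src≡
  ... | refl = cong (down i) (Edge-≡ e₁ e₂ (∷-injectiveʳ src≡) lab≡)

  elab-pres : ∀ {t s} (m : Hom ⌊ t ° ⌋ ⌊ s ° ⌋) (e : Edge t) → elab (fE m e) ≡ elab e
  elab-pres m e = ≡.sym (⊑-between-nums⇒≡ (elab-IsNum e) (elab-IsNum (fE m e)) (lE-mono m e))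

  °-hom-determined-by-root : ∀ {t s} (m₁ m₂ : Hom ⌊ t ° ⌋ ⌊ s ° ⌋) → fV m₁ ε ≡ fV m₂ ε → m₁ ≈ m₂
  °-hom-determined-by-root {t} m₁ m₂ root≡ = agreeV , λ e → agreeE e (agreeV (esrc e))
    where
    agreeE : ∀ e → fV m₁ (esrc e) ≡ fV m₂ (esrc e) → fE m₁ e ≡ fE m₂ e
    agreeE e src≡ = Edge-≡ (fE m₁ e) (fE m₂ e) (src-≡ m₁ m₂ e src≡)
      (trans (elab-pres m₁ e) (≡.sym (elab-pres m₂ e)))
    agreeV : ∀ q → fV m₁ q ≡ fV m₂ q
    agreeV = edge-induction _ root≡ λ e src≡ →
      trans (tgt-pres m₁ e) (trans (cong etgt (agreeE e src≡)) (≡.sym (tgt-pres m₂ e)))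

  IsOld : ∀ {G} → CV G → Set
  IsOld (old _) = ⊤
  IsOld _       = ⊥

  IsVar' : ∀ {G} → CV G → Set
  IsVar' (var' _ _) = ⊤
  IsVar' _          = ⊥

  old? : ∀ {G} (c : CV G) → Σ (V ⌊ G ⌋) (λ w → c ≡ old w) ⊎ ¬ IsOld c
  old? (old w)    = inj₁ (w , refl)
  old? (var' _ _) = inj₂ λ ()
  old? ctx        = inj₂ λ ()

  neither-old-nor-var'⇒ctx : ∀ {G} (c : CV G) → ¬ IsOld c → ¬ IsVar' c → c ≡ ctx
  neither-old-nor-var'⇒ctx (old _)    ¬old _     = ⊥-elim (¬old tt)
  neither-old-nor-var'⇒ctx (var' _ _) _    ¬var' = ⊥-elim (¬var' tt)
  neither-old-nor-var'⇒ctx ctx        _    _     = refl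

  old-injective : ∀ {G : RGraph} {a b} → _≡_ {A = CV G} (old a) (old b) → a ≡ b
  old-injective refl = refl

  var'-closed-under-edges : ∀ {G} (e : CE G) → IsVar' (csrc G e) → IsVar' (ctgt G e)
  var'-closed-under-edges (loopV _ _) _ = tt

  var'-spreads : ∀ {t G} (h : Hom ⌊ t ° ⌋ (𝓒 G)) → IsVar' (fV h ε) → ∀ q → IsVar' (fV h q)
  var'-spreads h root-var' = edge-induction _ root-var' λ e src-var' →
    subst IsVar' (≡.sym (tgt-pres h e))
      (var'-closed-under-edges (fE h e) (subst IsVar' (src-pres h e) src-var'))

  non-old-target-unique : ∀ {G} (e₁ e₂ : CE G) → csrc G e₁ ≡ csrc G e₂ →
    ¬ IsOld (ctgt G e₁) → ¬ IsOld (ctgt G e₂) → ctgt G e₁ ≡ ctgt G e₂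
  non-old-target-unique (old _) _ _ ¬old₁ _ = ⊥-elim (¬old₁ tt)
  non-old-target-unique toRoot  _ _ ¬old₁ _ = ⊥-elim (¬old₁ tt)
  non-old-target-unique _ (old _) _ _ ¬old₂ = ⊥-elim (¬old₂ tt)
  non-old-target-unique _ toRoot  _ _ ¬old₂ = ⊥-elim (¬old₂ tt)
  non-old-target-unique (toVar v p) (toVar v' p') src≡ _ _ with old-injective src≡
  ... | refl = cong (var' v) (T-irrelevant p p')
  non-old-target-unique (loopV _ _) (loopV _ _) src≡ _ _ = src≡
  non-old-target-unique loopC loopC _ _ _ = refl

  CE-≡ : ∀ {t a} (e₁ e₂ : CE (t °)) → csrc (t °) e₁ ≡ csrc (t °) e₂ → ctgt (t °) e₁ ≡ ctgt (t °) e₂ →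
    IsNum a → a ⊑ clE (t °) e₁ → a ⊑ clE (t °) e₂ → e₁ ≡ e₂
  CE-≡ (old e₁) (old e₂) src≡ _ a-num a⊑₁ a⊑₂ =
    cong old (Edge-≡ e₁ e₂ (old-injective src≡)
      (trans (≡.sym (⊑-between-nums⇒≡ a-num (elab-IsNum e₁) a⊑₁)) (⊑-between-nums⇒≡ a-num (elab-IsNum e₂) a⊑₂)))
  CE-≡ (toVar v p) (toVar v' p') src≡ _ _ _ _ with old-injective src≡
  ... | refl = cong (toVar v) (T-irrelevant p p')
  CE-≡ {t} (loopV v p) (loopV v' p') src≡ _ _ _ _ = var'-loop src≡
    where
    var'-loop : _≡_ {A = CV (t °)} (var' v p) (var' v' p') → loopV v p ≡ loopV v' p'
    var'-loop refl = refl
  CE-≡ toRoot toRoot _ _ _ _ _ = refl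
  CE-≡ loopC  loopC  _ _ _ _ _ = refl

  module Typing (ρ : Rule) (s : Term) where
    private
      Step° : Graph → Hom ⌊ Rule.lhs ρ ° ⌋ ⌊ s ° ⌋ → Set₁
      Step° G m = Step (ρ °ʳ) ⌊ s ° ⌋ G m

    typing-root-not-var' : ∀ {G m} (S : Step° G m) → ¬ IsVar' (fV (Step.α S) ε)
    typing-root-not-var' {m = m} S root-var' =
      subst IsVar' (proj₁ (Step.α-m S) ε) (var'-spreads (Step.α S) root-var' (fV m ε))

    typing-unique : ∀ {G₁ G₂ m₁ m₂} (S₁ : Step° G₁ m₁) (S₂ : Step° G₂ m₂) → m₁ ≈ m₂ →
      Step.α S₁ ≈ Step.α S₂
    typing-unique S₁ S₂ m₁≈m₂ = agreeV , λ e →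
      CE-≡ (fE α₁ e) (fE α₂ e) (src-≡ α₁ α₂ e (agreeV (esrc e))) (tgt-≡ α₁ α₂ e (agreeV (etgt e)))
        (elab-IsNum e) (lE-mono α₁ e) (lE-mono α₂ e)
      where
      α₁ α₂ : Hom ⌊ s ° ⌋ (𝓒 (Rule.lhs ρ °))
      α₁ = Step.α S₁
      α₂ = Step.α S₂

      agree-unless-both-non-old : ∀ v →
        (¬ IsOld (fV α₁ v) → ¬ IsOld (fV α₂ v) → fV α₁ v ≡ fV α₂ v) → fV α₁ v ≡ fV α₂ v
      agree-unless-both-non-old v non-old-case with old? (fV α₁ v) | old? (fV α₂ v)
      ... | inj₁ (_ , α₁v≡old) | _ =
        trans α₁v≡old (≡.sym (typings-agree-on-tL S₁ S₂ m₁≈m₂ α₁v≡old))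
      ... | inj₂ _ | inj₁ (_ , α₂v≡old) =
        trans (typings-agree-on-tL S₂ S₁ (≈-sym m₁≈m₂) α₂v≡old) (≡.sym α₂v≡old)
      ... | inj₂ ¬old₁ | inj₂ ¬old₂ = non-old-case ¬old₁ ¬old₂

      agreeV : ∀ v → fV α₁ v ≡ fV α₂ v
      agreeV = edge-induction _
        (agree-unless-both-non-old ε λ ¬old₁ ¬old₂ →
          trans (neither-old-nor-var'⇒ctx _ ¬old₁ (typing-root-not-var' S₁))
                (≡.sym (neither-old-nor-var'⇒ctx _ ¬old₂ (typing-root-not-var' S₂))))
        (λ e src≡ → agree-unless-both-non-old (etgt e) λ ¬old₁ ¬old₂ →
          trans (tgt-pres α₁ e)
            (trans (non-old-target-unique (fE α₁ e) (fE α₂ e) (src-≡ α₁ α₂ e src≡)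
                      (subst (¬_ ∘ IsOld) (tgt-pres α₁ e) ¬old₁)
                      (subst (¬_ ∘ IsOld) (tgt-pres α₂ e) ¬old₂))
              (≡.sym (tgt-pres α₂ e))))

lemma31 : (Sig : Signature) (X : Set) → let open Terms Sig X in
    (ρ : Rule) → LinearRule ρ → (s : Term) → Linear s → (p : Pos s) →
    (G₁ G₂ : Graph) → AppliedAt ρ s p G₁ → AppliedAt ρ s p G₂ → G₁ ≅ G₂
lemma31 Sig X ρ _ s _ _ _ _ (m₁ , root₁ , S₁) (m₂ , root₂ , S₂) =
  step-result-unique S₁ S₂ m₁≈m₂ (typing-unique S₁ S₂ m₁≈m₂)
  where
  open Terms Sig X using (_≈_)
  open TermGraphs Sig X
  open Typing ρ s
  open GraphCategory (Signature.Sym Sig)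
  m₁≈m₂ : m₁ ≈ m₂
  m₁≈m₂ = °-hom-determined-by-root m₁ m₂ (trans root₁ (≡.sym root₂))
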